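{- The set of cardinalities $|A|$ of subsets $A\subseteq\Omega$ with $\varepsilon_A\in\{f(x)d:x\in P,\ d\in D_1\}$ is exactly $\{0,6,8,10,16\}$.
   Context: Let $\Omega=\mathbb{F}_2^4$, $V=\mathbb{R}^{16}$ with orthonormal basis $(v_\omega)_{\omega\in\Omega}$. For $A\subseteq\Omega$ let $\varepsilon_A$ be the orthogonal map negating $v_\omega$ for $\omega\in A$ and fixing the others. Subsets of $\Omega$ are binary words (addition = symmetric difference); $RM(1,4)\subset RM(2,4)$ are the Reed–Muller codes on $\Omega$, $RM(r,4)$ spanned by affine subspaces of codimension $r$. $D=\{\varepsilon_A:A\in RM(2,4)\}$, $D_1=\{\varepsilon_A:A\in RM(1,4)\}$. $P\cong AGL(4,2)$ is the group of affine bijections of $\Omega$ acting by permutation matrices $v_\omega\mapsto v_{\omega g}$ (right actions), $T$ its translation subgroup; $P$ normalizes $D,D_1$ via $d^x=x^{ -1}dx$, so $D/D_1$ is a 6-dimensional $\mathbb{F}_2P$-module with $T$ acting trivially. Fix $f:P\to D$ whose composite $\bar f:P\to D/D_1$ satisfies $\bar f(xy)=\bar f(x)\bar f(y)^{x^{ -1}}$, chosen as follows: identify $P/T\cong GL(4,2)\cong Alt_8$ and $D/D_1$ with the module of even subsets of $\{1,\dots,8\}$ modulo $\{\emptyset,\{1,\dots,8\}\}$, and put $\bar f(g)=$ class of $\{1\}+\{1g\}$; its kernel $\{g:\bar f(g)=1\}$ is isomorphic to $2^4{:}Alt_7$. -}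

module Defs where

open import Data.Bool using (Bool; true; false; _xor_; _∧_; not; if_then_else_)
open import Data.Nat using (ℕ; zero; suc; _^_; _∸_; _<ᵇ_; _%_)
open import Data.Fin using (Fin; toℕ)
import Data.Fin as Fin
open import Data.Fin.Properties using (_≟_)
open import Data.Vec using (Vec; []; _∷_; zipWith; replicate)
import Data.Vec as Vec
open import Data.List using (List; []; _∷_; concatMap; map; allFin)
open import Data.Nat.ListAction using (sum)
open import Data.List.Relation.Unary.All using (All)
open import Data.Product using (Σ; ∃; _×_; _,_)
open import Data.Sum using (_⊎_)
open import Relation.Binary.PropositionalEquality using (_≡_)
open import Relation.Nullary.Decidable using (⌊_⌋)

-- F₂ is Bool (addition = xor, multiplication = ∧).
-- Ω = F₂⁴ (row vectors).

Ω : Set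
Ω = Vec Bool 4

_⊕_ : Ω → Ω → Ω
_⊕_ = zipWith _xor_

0Ω : Ω
0Ω = replicate 4 false

allVec : (n : ℕ) → List (Vec Bool n)
allVec zero = [] ∷ []
allVec (suc n) = concatMap (λ v → (false ∷ v) ∷ (true ∷ v) ∷ []) (allVec n)

allΩ : List Ω
allΩ = allVec 4

-- Subsets of Ω = binary words of length 16 = indicator functions Ω → Bool.  The element ε_A of D is represented
-- by A itself (A ↦ ε_A is injective and ε_A ε_B = ε_{A+B}).

SubΩ : Set
SubΩ = Ω → Bool

_+ₛ_ : SubΩ → SubΩ → SubΩ
(A +ₛ B) ω = A ω xor B ω

∅ₛ : SubΩ
∅ₛ _ = false

_≐_ : SubΩ → SubΩ → Set
A ≐ B = ∀ ω → A ω ≡ B ω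

card : SubΩ → ℕ
card A = sum (map (λ ω → if A ω then 1 else 0) allΩ)

sumₛ : List SubΩ → SubΩ
sumₛ [] = ∅ₛ
sumₛ (S ∷ L) = S +ₛ sumₛ L

-- Affine subspaces of Ω: nonempty subsets closed under x,y,z ↦ x+y+z.
-- Codimension r means cardinality 2^(4-r).

IsAffineSubspace : SubΩ → Set
IsAffineSubspace S =
  (∃ λ ω → S ω ≡ true) ×
  (∀ x y z → S x ≡ true → S y ≡ true → S z ≡ true → S ((x ⊕ y) ⊕ z) ≡ true)

AffineOfCodim : ℕ → SubΩ → Set
AffineOfCodim r S = IsAffineSubspace S × card S ≡ 2 ^ (4 ∸ r)

-- Reed–Muller code RM(r,4): the F₂-span of the affine subspaces of
-- codimension r, i.e. finite sums of such subspaces.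
RM : ℕ → SubΩ → Set
RM r A = Σ (List SubΩ) λ L → All (AffineOfCodim r) L × A ≐ sumₛ L

-- Matrices over F₂ acting on row vectors from the right: ω ↦ ω M.

Mat : Set
Mat = Vec Ω 4

vecMat : ∀ {n} → Vec Bool n → Vec Ω n → Ω
vecMat [] [] = 0Ω
vecMat (b ∷ bs) (r ∷ rs) = (if b then r else 0Ω) ⊕ vecMat bs rs

_⋆_ : Ω → Mat → Ω
ω ⋆ M = vecMat ω M

_⊗_ : Mat → Mat → Mat
M ⊗ N = Vec.map (λ row → row ⋆ N) M

I₄ : Mat
I₄ = (true ∷ false ∷ false ∷ false ∷ []) ∷
     (false ∷ true ∷ false ∷ false ∷ []) ∷
     (false ∷ false ∷ true ∷ false ∷ []) ∷
     (false ∷ false ∷ false ∷ true ∷ []) ∷ []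

record GL4 : Set where
  field
    mat inv : Mat
    mat⊗inv : mat ⊗ inv ≡ I₄
    inv⊗mat : inv ⊗ mat ≡ I₄
open GL4 public

-- P = AGL(4,2): affine bijections ω ↦ ω M + b.  Its image in P/T ≅ GL(4,2)
-- is the linear part.
record AGL4 : Set where
  field
    lin : GL4
    tr  : Ω
open AGL4 public

act : AGL4 → Ω → Ω
act x ω = (ω ⋆ mat (lin x)) ⊕ tr x

_◃_ : SubΩ → GL4 → SubΩ
(A ◃ g) ω = A (ω ⋆ inv g)

-- Sym(8), Alt(8) on {1,…,8} = Fin 8 (point "1" is Fin.zero).

record Perm8 : Set where
  field
    fun invp : Fin 8 → Fin 8
    invp∘fun : ∀ i → invp (fun i) ≡ i
    fun∘invp : ∀ i → fun (invp i) ≡ i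
open Perm8 public

inversions : Perm8 → ℕ
inversions σ = sum (concatMap (λ i → map (λ j →
  if (toℕ i <ᵇ toℕ j) ∧ (toℕ (fun σ j) <ᵇ toℕ (fun σ i)) then 1 else 0)
  (allFin 8)) (allFin 8))

IsEven : Perm8 → Set
IsEven σ = inversions σ % 2 ≡ 0

Sub8 : Set
Sub8 = Fin 8 → Bool

_+₈_ : Sub8 → Sub8 → Sub8
(S +₈ T) i = S i xor T i

∅₈ : Sub8
∅₈ _ = false

card8 : Sub8 → ℕ
card8 S = sum (map (λ i → if S i then 1 else 0) (allFin 8))

EvenSet : Sub8 → Set
EvenSet S = card8 S % 2 ≡ 0

-- equality in (even subsets) / {∅, {1..8}}
_~_ : Sub8 → Sub8 → Set
S ~ T = (∀ i → S i ≡ T i) ⊎ (∀ i → S i ≡ not (T i))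

_◃₈_ : Sub8 → Perm8 → Sub8
(S ◃₈ σ) i = S (invp σ i)

pair1 : Fin 8 → Sub8
pair1 j i = ⌊ i ≟ Fin.zero ⌋ xor ⌊ i ≟ j ⌋

-- The data fixed in the context: an identification φ : GL(4,2) ≅ Alt(8)
-- (for right actions), an equivariant F₂-isomorphism ψ : D/D₁ ≅ even sets
-- modulo {∅,{1..8}}, and f : P → D whose composite f̄ is g ↦ {1}+{1g}.

record Setup : Set where
  field
    φ      : GL4 → Perm8
    φ-even : ∀ g → IsEven (φ g)
    φ-hom  : ∀ g h k → mat k ≡ mat g ⊗ mat h →
             ∀ i → fun (φ k) i ≡ fun (φ h) (fun (φ g) i)
    φ-inj  : ∀ g h → (∀ i → fun (φ g) i ≡ fun (φ h) i) → mat g ≡ mat h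
    φ-surj : ∀ σ → IsEven σ → ∃ λ g → ∀ i → fun (φ g) i ≡ fun σ i

    ψ       : SubΩ → Sub8
    ψ-resp  : ∀ A B → A ≐ B → ψ A ~ ψ B
    ψ-even  : ∀ A → RM 2 A → EvenSet (ψ A)
    ψ-add   : ∀ A B → RM 2 A → RM 2 B → ψ (A +ₛ B) ~ (ψ A +₈ ψ B)
    ψ-ker   : ∀ A → RM 2 A → (ψ A ~ ∅₈ → RM 1 A) × (RM 1 A → ψ A ~ ∅₈)
    ψ-surj  : ∀ S → EvenSet S → ∃ λ A → RM 2 A × ψ A ~ S
    ψ-equiv : ∀ A g → RM 2 A → ψ (A ◃ g) ~ (ψ A ◃₈ φ g)

    f     : AGL4 → SubΩ
    f-D   : ∀ x → RM 2 (f x)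
    f-bar : ∀ x → ψ (f x) ~ pair1 (fun (φ (lin x)) Fin.zero)

module Submission where

-- A word of RM(2,4) is a Boolean function of degree at most two on F₂⁴, and modulo RM(1,4) it is
-- determined by the alternating polar form of its quadratic part: the coset has weights 0, 8, 16
-- when the form vanishes and 6, 10 when it is nondegenerate (its Pfaffian is 1).
-- If x ∈ P fixes the point 1, then f̄(x) = 0, so f(x) ∈ RM(1,4). Otherwise f̄(x) = {1, j} with j ≠ 1;
-- a five-cycle of Alt₈ fixing 1 and j lifts to g ∈ GL(4,2) of order five fixing f̄(x), so
-- f(x)g + f(x) ∈ RM(1,4) and g preserves the polar form of f(x), which is nonzero since f̄(x) ≠ 0.
-- An element of order five preserves no alternating form of rank two, so the form is nondegenerate.
-- The finite facts used (the degree of a function is read off its third derivatives, the degrees of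
-- affine subspaces, the weights of the cosets, the forms invariant under elements of order five)
-- are checked by exhaustive evaluation.

open import Defs
open import Algebra.Bundles using (CommutativeRing)
open import Data.Bool using (Bool; true; false; _∧_; _∨_; not; _xor_; if_then_else_; T)
open import Data.Bool.ListAction using (all)
open import Data.Bool.Properties
  using (T-∧; T-≡; xor-same; xor-assoc; xor-identityˡ; xor-identityʳ; xor-inverseˡ; not-involutive;
         ∧-distribˡ-xor; ∧-distribʳ-xor; xor-∧-commutativeRing)
  renaming (_≟_ to _≟ᵇ_)
open import Data.Fin using (Fin)
open import Data.Fin.Patterns using (0F; 1F; 2F; 3F)
open import Data.Fin.Properties using (_≟_; all?; any?)
open import Data.List using (List; []; _∷_; _++_)
import Data.List as List
import Data.List.Properties as List
open import Data.List.Membership.Propositional using (_∈_)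
open import Data.List.Relation.Unary.All using (All; []; _∷_)
open import Data.List.Relation.Unary.All.Properties using (++⁺)
open import Data.List.Relation.Unary.Any using (here; there; satisfied)
import Data.List.Relation.Unary.Any as Any
open import Data.Nat using (ℕ; zero; suc; _≡ᵇ_; _^_; _∸_; _%_)
import Data.Nat as ℕ
open import Data.Nat.GeneralisedArithmetic using (fold)
open import Data.Nat.ListAction using (sum)
open import Data.Nat.Properties using (≡ᵇ⇒≡; ≡⇒≡ᵇ)
open import Data.List.Membership.DecPropositional ℕ._≟_ using (_∈?_)
open import Data.Product using (Σ; ∃; _×_; _,_; proj₁; proj₂)
open import Data.Sum using (_⊎_; inj₁; inj₂; [_,_]′)
open import Data.Vec using (Vec; []; _∷_; zipWith; replicate; lookup)
import Data.Vec as Vec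
open import Data.Vec.Properties using (≡-dec; map-∘; map-cong; map-id; zipWith-identityˡ; zipWith-identityʳ)
open import Data.Vec.Relation.Unary.All using ([]; _∷_)
import Data.Vec.Relation.Unary.All as VecAll
open import Function using (_∘_; const)
open import Function.Bundles using (Equivalence; _⇔_; mk⇔)
open import Relation.Binary.Definitions using (DecidableEquality)
open import Relation.Binary.PropositionalEquality
  using (_≡_; _≢_; refl; sym; trans; cong; cong₂; subst; module ≡-Reasoning)
open import Relation.Nullary.Decidable
  using (Dec; yes; no; ⌊_⌋; toWitness; fromWitness; from-yes; map′; ¬?; _×-dec_; _⊎-dec_; _→-dec_)
open import Relation.Nullary.Negation using (contradiction)
open import Relation.Unary using (Decidable)

open import Algebra.Properties.CommutativeSemigroup
  (CommutativeRing.+-commutativeSemigroup xor-∧-commutativeRing) using (interchange)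

_⇒ᵇ_ : Bool → Bool → Bool
a ⇒ᵇ b = not a ∨ b

⇒ᵇ-elim : ∀ {a b} → T (a ⇒ᵇ b) → T a → T b
⇒ᵇ-elim {true} h _ = h

⇒ᵇ-intro : ∀ a {b} → (T a → T b) → T (a ⇒ᵇ b)
⇒ᵇ-intro true  h = h _
⇒ᵇ-intro false h = _

T⇒≡ : ∀ {b} → T b → b ≡ true
T⇒≡ = Equivalence.to T-≡

≡⇒T : ∀ {b} → b ≡ true → T b
≡⇒T = Equivalence.from T-≡

∧-fst : ∀ {a b} → T (a ∧ b) → T a
∧-fst {true} _ = _

∧-snd : ∀ {a b} → T (a ∧ b) → T b
∧-snd {true} h = h

xor≡false⇒≡ : ∀ a b → a xor b ≡ false → a ≡ b
xor≡false⇒≡ true  true  _ = refl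
xor≡false⇒≡ false false _ = refl

∀ᵇ : ∀ n → (Vec Bool n → Bool) → Bool
∀ᵇ zero    p = p []
∀ᵇ (suc n) p = ∀ᵇ n (p ∘ (false ∷_)) ∧ ∀ᵇ n (p ∘ (true ∷_))

∀ᵇ-sound : ∀ n p → T (∀ᵇ n p) → ∀ v → T (p v)
∀ᵇ-sound zero    p h []          = h
∀ᵇ-sound (suc n) p h (false ∷ v) = ∀ᵇ-sound n _ (proj₁ (Equivalence.to T-∧ h)) v
∀ᵇ-sound (suc n) p h (true ∷ v)  = ∀ᵇ-sound n _ (proj₂ (Equivalence.to T-∧ h)) v

∀ᵇ-complete : ∀ n p → (∀ v → T (p v)) → T (∀ᵇ n p)
∀ᵇ-complete zero    p h = h []
∀ᵇ-complete (suc n) p h =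
  Equivalence.from T-∧ (∀ᵇ-complete n _ (h ∘ (false ∷_)) , ∀ᵇ-complete n _ (h ∘ (true ∷_)))

-- Checks are passed as `b ≡ true` and proved by refl: elaborating a proof of `T b` against an
-- unknown `T _` makes Agda normalise b with its slow reduction machinery.
by-exhaustion : ∀ n {P : Vec Bool n → Set} (P? : Decidable P) →
                ∀ᵇ n (⌊_⌋ ∘ P?) ≡ true → ∀ v → P v
by-exhaustion n P? h v = toWitness (∀ᵇ-sound n _ (≡⇒T h) v)

∀Ω³ : (Ω → Ω → Ω → Bool) → Bool
∀Ω³ p = ∀ᵇ 4 λ x → ∀ᵇ 4 λ u → ∀ᵇ 4 λ v → p x u v

by-exhaustion³ : {P : Ω → Ω → Ω → Set} (P? : ∀ x u v → Dec (P x u v)) →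
                 ∀Ω³ (λ x u v → ⌊ P? x u v ⌋) ≡ true → ∀ x u v → P x u v
by-exhaustion³ P? h x u v =
  toWitness (∀ᵇ-sound 4 (λ v → ⌊ P? x u v ⌋)
              (∀ᵇ-sound 4 (λ u → ∀ᵇ 4 λ v → ⌊ P? x u v ⌋)
                 (∀ᵇ-sound 4 (λ x → ∀ᵇ 4 λ u → ∀ᵇ 4 λ v → ⌊ P? x u v ⌋) (≡⇒T h) x) u) v)

infixl 6 _⊕ᵥ_
_⊕ᵥ_ : ∀ {n} → Vec Bool n → Vec Bool n → Vec Bool n
_⊕ᵥ_ = zipWith _xor_

infix 4 _≟Ω_
_≟Ω_ : DecidableEquality Ω
_≟Ω_ = ≡-dec _≟ᵇ_

⊕-identityˡ : ∀ x → 0Ω ⊕ x ≡ x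
⊕-identityˡ = zipWith-identityˡ xor-identityˡ

⊕-identityʳ : ∀ x → x ⊕ 0Ω ≡ x
⊕-identityʳ = zipWith-identityʳ xor-identityʳ

⊕-same : ∀ {n} (x : Vec Bool n) → x ⊕ᵥ x ≡ replicate n false
⊕-same []       = refl
⊕-same (a ∷ as) = cong₂ _∷_ (xor-same a) (⊕-same as)

⊕-interchange : ∀ {n} (a b c d : Vec Bool n) → (a ⊕ᵥ b) ⊕ᵥ (c ⊕ᵥ d) ≡ (a ⊕ᵥ c) ⊕ᵥ (b ⊕ᵥ d)
⊕-interchange []       []       []       []       = refl
⊕-interchange (a ∷ as) (b ∷ bs) (c ∷ cs) (d ∷ ds) =
  cong₂ _∷_ (interchange a b c d) (⊕-interchange as bs cs ds)

select-xor : ∀ a b r → (if a xor b then r else 0Ω) ≡ (if a then r else 0Ω) ⊕ (if b then r else 0Ω)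
select-xor true  true  r = sym (⊕-same r)
select-xor true  false r = sym (⊕-identityʳ r)
select-xor false true  r = sym (⊕-identityˡ r)
select-xor false false r = refl

vecMat-⊕ : ∀ {n} (x y : Vec Bool n) (rs : Vec Ω n) → vecMat (x ⊕ᵥ y) rs ≡ vecMat x rs ⊕ vecMat y rs
vecMat-⊕ []      []      []       = refl
vecMat-⊕ (a ∷ x) (b ∷ y) (r ∷ rs) = begin
  (if a xor b then r else 0Ω) ⊕ vecMat (x ⊕ᵥ y) rs
    ≡⟨ cong₂ _⊕_ (select-xor a b r) (vecMat-⊕ x y rs) ⟩
  ((if a then r else 0Ω) ⊕ (if b then r else 0Ω)) ⊕ (vecMat x rs ⊕ vecMat y rs)
    ≡⟨ ⊕-interchange _ _ _ _ ⟩
  ((if a then r else 0Ω) ⊕ vecMat x rs) ⊕ ((if b then r else 0Ω) ⊕ vecMat y rs) ∎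
  where open ≡-Reasoning

⋆-distribʳ-⊕ : ∀ x y M → (x ⊕ y) ⋆ M ≡ (x ⋆ M) ⊕ (y ⋆ M)
⋆-distribʳ-⊕ x y M = vecMat-⊕ x y M

0⋆ : ∀ M → 0Ω ⋆ M ≡ 0Ω
0⋆ (_ ∷ _ ∷ _ ∷ _ ∷ []) = refl

select-⋆ : ∀ a r N → (if a then r else 0Ω) ⋆ N ≡ (if a then r ⋆ N else 0Ω)
select-⋆ true  r N = refl
select-⋆ false r N = 0⋆ N

vecMat-⋆ : ∀ {n} (x : Vec Bool n) (M : Vec Ω n) (N : Mat) →
           vecMat x M ⋆ N ≡ vecMat x (Vec.map (_⋆ N) M)
vecMat-⋆ []      []      N = 0⋆ N
vecMat-⋆ (a ∷ x) (r ∷ M) N =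
  trans (⋆-distribʳ-⊕ (if a then r else 0Ω) (vecMat x M) N) (cong₂ _⊕_ (select-⋆ a r N) (vecMat-⋆ x M N))

⋆-⊗ : ∀ x M N → (x ⋆ M) ⋆ N ≡ x ⋆ (M ⊗ N)
⋆-⊗ = vecMat-⋆

⊗-assoc : ∀ A B C → (A ⊗ B) ⊗ C ≡ A ⊗ (B ⊗ C)
⊗-assoc A B C = trans (sym (map-∘ (_⋆ C) (_⋆ B) A)) (map-cong (λ r → ⋆-⊗ r B C) A)

⋆-identityʳ : ∀ x → x ⋆ I₄ ≡ x
⋆-identityʳ = by-exhaustion 4 (λ x → x ⋆ I₄ ≟Ω x) refl

⊗-identityʳ : ∀ A → A ⊗ I₄ ≡ A
⊗-identityʳ A = trans (map-cong ⋆-identityʳ A) (map-id A)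

_^ᴹ_ : Mat → ℕ → Mat
M ^ᴹ zero  = I₄
M ^ᴹ suc n = (M ^ᴹ n) ⊗ M

1ᴳ : GL4
1ᴳ = record { mat = I₄ ; inv = I₄ ; mat⊗inv = refl ; inv⊗mat = refl }

⊗-inverse-product : ∀ {G G' H H'} → G ⊗ G' ≡ I₄ → H ⊗ H' ≡ I₄ → (G ⊗ H) ⊗ (H' ⊗ G') ≡ I₄
⊗-inverse-product {G} {G'} {H} {H'} gg' hh' = begin
  (G ⊗ H) ⊗ (H' ⊗ G') ≡⟨ sym (⊗-assoc (G ⊗ H) H' G') ⟩
  ((G ⊗ H) ⊗ H') ⊗ G' ≡⟨ cong (_⊗ G') (⊗-assoc G H H') ⟩
  (G ⊗ (H ⊗ H')) ⊗ G' ≡⟨ cong (λ M → (G ⊗ M) ⊗ G') hh' ⟩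
  (G ⊗ I₄) ⊗ G'       ≡⟨ cong (_⊗ G') (⊗-identityʳ G) ⟩
  G ⊗ G'              ≡⟨ gg' ⟩
  I₄                  ∎
  where open ≡-Reasoning

⋆-cancel : ∀ g u → (u ⋆ mat g) ⋆ inv g ≡ u
⋆-cancel g u = trans (⋆-⊗ u (mat g) (inv g)) (trans (cong (u ⋆_) (mat⊗inv g)) (⋆-identityʳ u))

_·ᴳ_ : GL4 → GL4 → GL4
g ·ᴳ h = record
  { mat = mat g ⊗ mat h ; inv = inv h ⊗ inv g
  ; mat⊗inv = ⊗-inverse-product (mat⊗inv g) (mat⊗inv h)
  ; inv⊗mat = ⊗-inverse-product (inv⊗mat h) (inv⊗mat g) }

_^ᴳ_ : GL4 → ℕ → GL4
g ^ᴳ zero  = 1ᴳ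
g ^ᴳ suc n = (g ^ᴳ n) ·ᴳ g

mat-^ᴳ : ∀ g n → mat (g ^ᴳ n) ≡ mat g ^ᴹ n
mat-^ᴳ g zero    = refl
mat-^ᴳ g (suc n) = cong (_⊗ mat g) (mat-^ᴳ g n)

infix 7 _·_
_·_ : ∀ {n} → Vec Bool n → Vec Bool n → Bool
[]       · _ = false
(a ∷ as) · x = (a ∧ Vec.head x) xor (as · Vec.tail x)

·-distribˡ-⊕ : ∀ {n} (c x y : Vec Bool n) → c · (x ⊕ᵥ y) ≡ (c · x) xor (c · y)
·-distribˡ-⊕ []       []       []       = refl
·-distribˡ-⊕ (c ∷ cs) (x ∷ xs) (y ∷ ys) =
  trans (cong₂ _xor_ (∧-distribˡ-xor c x y) (·-distribˡ-⊕ cs xs ys))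
        (interchange (c ∧ x) (c ∧ y) (cs · xs) (cs · ys))

·-distribʳ-⊕ : ∀ {n} (a b x : Vec Bool n) → (a ⊕ᵥ b) · x ≡ (a · x) xor (b · x)
·-distribʳ-⊕ []       []       []       = refl
·-distribʳ-⊕ (a ∷ as) (b ∷ bs) (x ∷ xs) =
  trans (cong₂ _xor_ (∧-distribʳ-xor x a b) (·-distribʳ-⊕ as bs xs))
        (interchange (a ∧ x) (b ∧ x) (as · xs) (bs · xs))

·-zeroʳ : ∀ {n} (c : Vec Bool n) → c · replicate n false ≡ false
·-zeroʳ []       = refl
·-zeroʳ (true ∷ cs)  = ·-zeroʳ cs
·-zeroʳ (false ∷ cs) = ·-zeroʳ cs

-- Discrete derivatives

parity : List Bool → Bool
parity = List.foldr _xor_ false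

parity-++ : ∀ xs ys → parity (xs List.++ ys) ≡ parity xs xor parity ys
parity-++ []       ys = refl
parity-++ (x ∷ xs) ys = trans (cong (x xor_) (parity-++ xs ys)) (sym (xor-assoc x (parity xs) (parity ys)))

parity-map-+ : ∀ F G ps → parity (List.map (F +ₛ G) ps) ≡ parity (List.map F ps) xor parity (List.map G ps)
parity-map-+ F G []       = refl
parity-map-+ F G (p ∷ ps) =
  trans (cong ((F p xor G p) xor_) (parity-map-+ F G ps))
        (interchange (F p) (G p) (parity (List.map F ps)) (parity (List.map G ps)))

parityⱽ : ∀ {n} → List (Vec Bool n) → Vec Bool n
parityⱽ = List.foldr _⊕ᵥ_ (replicate _ false)

·-parityⱽ : ∀ {n} (c : Vec Bool n) vs → c · parityⱽ vs ≡ parity (List.map (c ·_) vs)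
·-parityⱽ c []       = ·-zeroʳ c
·-parityⱽ c (v ∷ vs) = trans (·-distribˡ-⊕ c v (parityⱽ vs)) (cong ((c · v) xor_) (·-parityⱽ c vs))

parallelepiped : Ω → List Ω → List Ω
parallelepiped x []       = x ∷ []
parallelepiped x (u ∷ us) = parallelepiped x us List.++ parallelepiped (x ⊕ u) us

Δ : List Ω → SubΩ → Ω → Bool
Δ us F x = parity (List.map F (parallelepiped x us))

Δⱽ : ∀ {n} → List Ω → (Ω → Vec Bool n) → Ω → Vec Bool n
Δⱽ us M x = parityⱽ (List.map M (parallelepiped x us))

Δ-∷ : ∀ u us F x → Δ (u ∷ us) F x ≡ Δ us F x xor Δ us F (x ⊕ u)
Δ-∷ u us F x = trans (cong parity (List.map-++ F (parallelepiped x us) (parallelepiped (x ⊕ u) us)))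
                     (parity-++ (List.map F (parallelepiped x us)) (List.map F (parallelepiped (x ⊕ u) us)))

Δ-+ : ∀ us F G x → Δ us (F +ₛ G) x ≡ Δ us F x xor Δ us G x
Δ-+ us F G x = parity-map-+ F G (parallelepiped x us)

Δ-resp : ∀ us {F G} → F ≐ G → ∀ x → Δ us F x ≡ Δ us G x
Δ-resp us F≐G x = cong parity (List.map-cong F≐G (parallelepiped x us))

Δ-· : ∀ {n} us (c : Vec Bool n) M x → Δ us (λ ω → c · M ω) x ≡ c · Δⱽ us M x
Δ-· us c M x = sym (trans (·-parityⱽ c (List.map M (parallelepiped x us)))
                          (cong parity (sym (List.map-∘ (parallelepiped x us)))))

parallelepiped-⋆ : ∀ x us N →
  List.map (_⋆ N) (parallelepiped x us) ≡ parallelepiped (x ⋆ N) (List.map (_⋆ N) us)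
parallelepiped-⋆ x []       N = refl
parallelepiped-⋆ x (u ∷ us) N = begin
  List.map (_⋆ N) (parallelepiped x us List.++ parallelepiped (x ⊕ u) us)
    ≡⟨ List.map-++ (_⋆ N) (parallelepiped x us) (parallelepiped (x ⊕ u) us) ⟩
  List.map (_⋆ N) (parallelepiped x us) List.++ List.map (_⋆ N) (parallelepiped (x ⊕ u) us)
    ≡⟨ cong₂ List._++_ (parallelepiped-⋆ x us N) (parallelepiped-⋆ (x ⊕ u) us N) ⟩
  parallelepiped (x ⋆ N) (List.map (_⋆ N) us) List.++ parallelepiped ((x ⊕ u) ⋆ N) (List.map (_⋆ N) us)
    ≡⟨ cong (λ y → parallelepiped (x ⋆ N) (List.map (_⋆ N) us) List.++ parallelepiped y (List.map (_⋆ N) us))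
            (⋆-distribʳ-⊕ x u N) ⟩
  parallelepiped (x ⋆ N) (List.map (_⋆ N) us) List.++ parallelepiped ((x ⋆ N) ⊕ (u ⋆ N)) (List.map (_⋆ N) us) ∎
  where open ≡-Reasoning

Δ-∘⋆ : ∀ us F N x → Δ us (λ ω → F (ω ⋆ N)) x ≡ Δ (List.map (_⋆ N) us) F (x ⋆ N)
Δ-∘⋆ us F N x = cong parity (trans (List.map-∘ (parallelepiped x us)) (cong (List.map F) (parallelepiped-⋆ x us N)))

-- Algebraic normal forms of degree at most two

coord : Fin 4 → Ω → Bool
coord i ω = lookup ω i

pairs : Vec (Fin 4 × Fin 4) 6
pairs = (0F , 1F) ∷ (0F , 2F) ∷ (0F , 3F) ∷ (1F , 2F) ∷ (1F , 3F) ∷ (2F , 3F) ∷ []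

affineMonomials : Vec SubΩ 5
affineMonomials = const true ∷ coord 0F ∷ coord 1F ∷ coord 2F ∷ coord 3F ∷ []

quadMonomials : Vec SubΩ 6
quadMonomials = Vec.map (λ (i , j) ω → coord i ω ∧ coord j ω) pairs

values : ∀ {n} → Vec SubΩ n → Ω → Vec Bool n
values ms ω = Vec.map (λ m → m ω) ms

record ANF : Set where
  constructor anf
  field
    affinePart : Vec Bool 5  -- coefficients of 1, x₀, x₁, x₂, x₃
    quadPart   : Vec Bool 6  -- coefficients of x₀x₁, x₀x₂, x₀x₃, x₁x₂, x₁x₃, x₂x₃
open ANF public

evalANF : ANF → SubΩ
evalANF q ω = (affinePart q · values affineMonomials ω) xor (quadPart q · values quadMonomials ω)

infixl 6 _⊞_
_⊞_ : ANF → ANF → ANF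
p ⊞ q = anf (affinePart p ⊕ᵥ affinePart q) (quadPart p ⊕ᵥ quadPart q)

0⁶ : Vec Bool 6
0⁶ = replicate 6 false

affine : Vec Bool 5 → ANF
affine a = anf a 0⁶

infix 4 _≟ⱽ_ _≟ᴬ_
_≟ⱽ_ : ∀ {n} → DecidableEquality (Vec Bool n)
_≟ⱽ_ = ≡-dec _≟ᵇ_

_≟ᴬ_ : DecidableEquality ANF
anf a b ≟ᴬ anf a' b' =
  map′ (λ (p , q) → cong₂ anf p q) (λ { refl → refl , refl }) ((a ≟ⱽ a') ×-dec (b ≟ⱽ b'))

evalANF-⊞ : ∀ p q ω → evalANF (p ⊞ q) ω ≡ evalANF p ω xor evalANF q ω
evalANF-⊞ (anf a b) (anf a' b') ω =
  trans (cong₂ _xor_ (·-distribʳ-⊕ a a' (values affineMonomials ω)) (·-distribʳ-⊕ b b' (values quadMonomials ω)))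
        (interchange (a · values affineMonomials ω) (a' · values affineMonomials ω)
                     (b · values quadMonomials ω) (b' · values quadMonomials ω))

polarVector : Ω → Ω → Vec Bool 6
polarVector u v = Vec.map (λ (i , j) → (coord i u ∧ coord j v) xor (coord j u ∧ coord i v)) pairs

polar : Vec Bool 6 → Ω → Ω → Bool
polar b u v = b · polarVector u v

Δⱽ-affineMonomials : ∀ x u v → Δⱽ (u ∷ v ∷ []) (values affineMonomials) x ≡ replicate 5 false
Δⱽ-affineMonomials =
  by-exhaustion³ (λ x u v → Δⱽ (u ∷ v ∷ []) (values affineMonomials) x ≟ⱽ replicate 5 false) refl

Δⱽ-quadMonomials : ∀ x u v → Δⱽ (u ∷ v ∷ []) (values quadMonomials) x ≡ polarVector u v
Δⱽ-quadMonomials =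
  by-exhaustion³ (λ x u v → Δⱽ (u ∷ v ∷ []) (values quadMonomials) x ≟ⱽ polarVector u v) refl

Δ²-evalANF : ∀ q x u v → Δ (u ∷ v ∷ []) (evalANF q) x ≡ polar (quadPart q) u v
Δ²-evalANF (anf a b) x u v = begin
  Δ uv (evalANF (anf a b)) x
    ≡⟨ Δ-+ uv affinePart′ quadPart′ x ⟩
  Δ uv affinePart′ x xor Δ uv quadPart′ x
    ≡⟨ cong₂ _xor_ (Δ-· uv a (values affineMonomials) x) (Δ-· uv b (values quadMonomials) x) ⟩
  (a · Δⱽ uv (values affineMonomials) x) xor (b · Δⱽ uv (values quadMonomials) x)
    ≡⟨ cong₂ (λ s t → (a · s) xor (b · t)) (Δⱽ-affineMonomials x u v) (Δⱽ-quadMonomials x u v) ⟩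
  (a · replicate 5 false) xor polar b u v
    ≡⟨ cong (_xor polar b u v) (·-zeroʳ a) ⟩
  polar b u v ∎
  where
  open ≡-Reasoning
  uv = u ∷ v ∷ []
  affinePart′ quadPart′ : SubΩ
  affinePart′ ω = a · values affineMonomials ω
  quadPart′   ω = b · values quadMonomials ω

-- Möbius inversion: the coefficient of x^S is the derivative of F at 0 in the directions e_i, i ∈ S.
anfOf : SubΩ → ANF
anfOf F = anf (F 0Ω ∷ Vec.map (λ e → F 0Ω xor F e) I₄)
              (Vec.map (λ (i , j) → Δ (lookup I₄ i ∷ lookup I₄ j ∷ []) F 0Ω) pairs)

anfOf-resp : ∀ {F G} → F ≐ G → anfOf F ≡ anfOf G
anfOf-resp F≐G =
  cong₂ anf (cong₂ _∷_ (F≐G 0Ω) (map-cong (λ e → cong₂ _xor_ (F≐G 0Ω) (F≐G e)) I₄))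
            (map-cong (λ (i , j) → Δ-resp (lookup I₄ i ∷ lookup I₄ j ∷ []) F≐G 0Ω) pairs)

∀ᴬ : (ANF → Bool) → Bool
∀ᴬ p = ∀ᵇ 5 λ a → ∀ᵇ 6 λ b → p (anf a b)

∀ᴬ-sound : ∀ p → ∀ᴬ p ≡ true → ∀ q → T (p q)
∀ᴬ-sound p h (anf a b) = ∀ᵇ-sound 6 (λ b → p (anf a b)) (∀ᵇ-sound 5 (λ a → ∀ᵇ 6 λ b → p (anf a b)) (≡⇒T h) a) b

anfOf-evalANF : ∀ q → anfOf (evalANF q) ≡ q
anfOf-evalANF q = toWitness {a? = anfOf (evalANF q) ≟ᴬ q} (∀ᴬ-sound (λ q → ⌊ anfOf (evalANF q) ≟ᴬ q ⌋) refl q)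

evalANF-injective : ∀ {p q} → evalANF p ≐ evalANF q → p ≡ q
evalANF-injective {p} {q} e = trans (sym (anfOf-evalANF p)) (trans (anfOf-resp e) (anfOf-evalANF q))

Degree≤2 : SubΩ → Set
Degree≤2 F = Σ ANF λ q → F ≐ evalANF q

Degree≤1 : SubΩ → Set
Degree≤1 F = Σ (Vec Bool 5) λ a → F ≐ evalANF (affine a)

Degree≤2-resp : ∀ {F G} → F ≐ G → Degree≤2 F → Degree≤2 G
Degree≤2-resp F≐G (q , F≐q) = q , λ ω → trans (sym (F≐G ω)) (F≐q ω)

Degree≤1-resp : ∀ {F G} → F ≐ G → Degree≤1 F → Degree≤1 G
Degree≤1-resp F≐G (a , F≐a) = a , λ ω → trans (sym (F≐G ω)) (F≐a ω)

Degree≤2-+ : ∀ {F G} → Degree≤2 F → Degree≤2 G → Degree≤2 (F +ₛ G)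
Degree≤2-+ (p , F≐p) (q , G≐q) = p ⊞ q , λ ω → trans (cong₂ _xor_ (F≐p ω) (G≐q ω)) (sym (evalANF-⊞ p q ω))

Degree≤1-+ : ∀ {F G} → Degree≤1 F → Degree≤1 G → Degree≤1 (F +ₛ G)
Degree≤1-+ (a , F≐a) (a' , G≐a') =
  a ⊕ᵥ a' , λ ω → trans (cong₂ _xor_ (F≐a ω) (G≐a' ω)) (sym (evalANF-⊞ (affine a) (affine a') ω))

Δ²-polar : ∀ {F q} → F ≐ evalANF q → ∀ x u v → Δ (u ∷ v ∷ []) F x ≡ polar (quadPart q) u v
Δ²-polar {q = q} F≐q x u v = trans (Δ-resp (u ∷ v ∷ []) F≐q x) (Δ²-evalANF q x u v)

Degree≤1-Δ² : ∀ {F} → Degree≤1 F → ∀ x u v → Δ (u ∷ v ∷ []) F x ≡ false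
Degree≤1-Δ² (a , F≐a) = Δ²-polar {q = affine a} F≐a

Table : ℕ → Set
Table zero    = Bool
Table (suc n) = Table n × Table n

lookupᵀ : ∀ {n} → Table n → Vec Bool n → Bool
lookupᵀ {zero}  b       []          = b
lookupᵀ {suc n} (l , r) (false ∷ v) = lookupᵀ l v
lookupᵀ {suc n} (l , r) (true ∷ v)  = lookupᵀ r v

tabulateᵀ : ∀ n → (Vec Bool n → Bool) → Table n
tabulateᵀ zero    F = F []
tabulateᵀ (suc n) F = tabulateᵀ n (F ∘ (false ∷_)) , tabulateᵀ n (F ∘ (true ∷_))

lookup-tabulateᵀ : ∀ n F v → lookupᵀ (tabulateᵀ n F) v ≡ F v
lookup-tabulateᵀ zero    F []          = refl
lookup-tabulateᵀ (suc n) F (false ∷ v) = lookup-tabulateᵀ n (F ∘ (false ∷_)) v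
lookup-tabulateᵀ (suc n) F (true ∷ v)  = lookup-tabulateᵀ n (F ∘ (true ∷_)) v

∀ᵀ : ∀ n → (Table n → Bool) → Bool
∀ᵀ zero    p = p false ∧ p true
∀ᵀ (suc n) p = ∀ᵀ n λ l → ∀ᵀ n λ r → p (l , r)

∀ᵀ-soundᵀ : ∀ n p → T (∀ᵀ n p) → ∀ t → T (p t)
∀ᵀ-soundᵀ zero    p h false   = proj₁ (Equivalence.to T-∧ h)
∀ᵀ-soundᵀ zero    p h true    = proj₂ (Equivalence.to T-∧ h)
∀ᵀ-soundᵀ (suc n) p h (l , r) =
  ∀ᵀ-soundᵀ n (λ r → p (l , r)) (∀ᵀ-soundᵀ n (λ l → ∀ᵀ n λ r → p (l , r)) h l) r

∀ᵀ-sound : ∀ n p → ∀ᵀ n p ≡ true → ∀ t → T (p t)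
∀ᵀ-sound n p h = ∀ᵀ-soundᵀ n p (≡⇒T h)

tabulated : SubΩ → SubΩ
tabulated F = lookupᵀ (tabulateᵀ 4 F)

tabulated-≐ : ∀ F → tabulated F ≐ F
tabulated-≐ F = lookup-tabulateᵀ 4 F

_=ᶠ_ : SubΩ → SubΩ → Bool
F =ᶠ G = ∀ᵇ 4 λ ω → ⌊ F ω ≟ᵇ G ω ⌋

=ᶠ-sound : ∀ F G → T (F =ᶠ G) → F ≐ G
=ᶠ-sound F G h = by-exhaustion 4 (λ ω → F ω ≟ᵇ G ω) (T⇒≡ h)

e₀ e₁ e₂ e₃ : Ω
e₀ = lookup I₄ 0F
e₁ = lookup I₄ 1F
e₂ = lookup I₄ 2F
e₃ = lookup I₄ 3F

highDirections : Vec (List Ω) 5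
highDirections = (e₀ ∷ e₁ ∷ e₂ ∷ []) ∷ (e₀ ∷ e₁ ∷ e₃ ∷ []) ∷ (e₀ ∷ e₂ ∷ e₃ ∷ []) ∷ (e₁ ∷ e₂ ∷ e₃ ∷ []) ∷
                 (e₀ ∷ e₁ ∷ e₂ ∷ e₃ ∷ []) ∷ []

highCoefficientsOn : Vec (List Ω) 5 → SubΩ → Vec Bool 5
highCoefficientsOn cubes F = Vec.map (λ c → parity (List.map F c)) cubes

highCubes : Vec (List Ω) 5
highCubes = Vec.map (parallelepiped 0Ω) highDirections

highCoefficients : SubΩ → Vec Bool 5
highCoefficients = highCoefficientsOn highCubes

highCoefficients-resp : ∀ {F G} → F ≐ G → highCoefficients F ≡ highCoefficients G
highCoefficients-resp F≐G = map-cong (λ us → Δ-resp us F≐G 0Ω) highDirections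

-- The parallelepipeds are an argument of the check so that they are evaluated once, not once per table.
anfCheck : Vec (List Ω) 5 → Table 4 → Bool
anfCheck cubes t =
  ⌊ highCoefficientsOn cubes (lookupᵀ t) ≟ⱽ replicate 5 false ⌋ ⇒ᵇ (lookupᵀ t =ᶠ evalANF (anfOf (lookupᵀ t)))

anfCheck-passes : ∀ᵀ 4 (anfCheck highCubes) ≡ true
anfCheck-passes = refl

anfOf-sound : ∀ F → highCoefficients F ≡ replicate 5 false → F ≐ evalANF (anfOf F)
anfOf-sound F high≡0 ω = begin
  F ω                 ≡⟨ tabulated-≐ F ω ⟨
  G ω                 ≡⟨ =ᶠ-sound G (evalANF (anfOf G)) (⇒ᵇ-elim check-G high-G) ω ⟩
  evalANF (anfOf G) ω ≡⟨ cong (λ q → evalANF q ω) (anfOf-resp (tabulated-≐ F)) ⟩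
  evalANF (anfOf F) ω ∎
  where
  open ≡-Reasoning
  G = tabulated F
  check-G : T (anfCheck highCubes (tabulateᵀ 4 F))
  check-G = ∀ᵀ-sound 4 (anfCheck highCubes) anfCheck-passes (tabulateᵀ 4 F)
  high-G : T ⌊ highCoefficients G ≟ⱽ replicate 5 false ⌋
  high-G = fromWitness (trans (highCoefficients-resp (tabulated-≐ F)) high≡0)

Δ³-vanishing⇒Degree≤2 : ∀ F → (∀ x u v w → Δ (u ∷ v ∷ w ∷ []) F x ≡ false) → Degree≤2 F
Δ³-vanishing⇒Degree≤2 F Δ³≡0 = anfOf F , anfOf-sound F high≡0
  where
  quartic : Δ (e₀ ∷ e₁ ∷ e₂ ∷ e₃ ∷ []) F 0Ω ≡ false
  quartic = trans (Δ-∷ e₀ (e₁ ∷ e₂ ∷ e₃ ∷ []) F 0Ω) (cong₂ _xor_ (Δ³≡0 0Ω e₁ e₂ e₃) (Δ³≡0 (0Ω ⊕ e₀) e₁ e₂ e₃))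
  high≡0 : highCoefficients F ≡ replicate 5 false
  high≡0 = cong₂ _∷_ (Δ³≡0 0Ω e₀ e₁ e₂) (cong₂ _∷_ (Δ³≡0 0Ω e₀ e₁ e₃) (cong₂ _∷_ (Δ³≡0 0Ω e₀ e₂ e₃)
           (cong₂ _∷_ (Δ³≡0 0Ω e₁ e₂ e₃) (cong₂ _∷_ quartic refl))))

Closed : SubΩ → Set
Closed S = ∀ x y z → S x ≡ true → S y ≡ true → S z ≡ true → S ((x ⊕ y) ⊕ z) ≡ true

closedᵇ : SubΩ → Bool
closedᵇ S = ∀ᵇ 4 λ x → S x ⇒ᵇ (∀ᵇ 4 λ y → S y ⇒ᵇ (∀ᵇ 4 λ z → S z ⇒ᵇ S ((x ⊕ y) ⊕ z)))

closedᵇ-sound : ∀ S → T (closedᵇ S) → Closed S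
closedᵇ-sound S h x y z Sx Sy Sz = T⇒≡ (⇒ᵇ-elim (∀ᵇ-sound 4 (λ z → S z ⇒ᵇ S ((x ⊕ y) ⊕ z)) hz z) (≡⇒T Sz))
  where
  hy = ⇒ᵇ-elim (∀ᵇ-sound 4 (λ x → S x ⇒ᵇ (∀ᵇ 4 λ y → S y ⇒ᵇ (∀ᵇ 4 λ z → S z ⇒ᵇ S ((x ⊕ y) ⊕ z)))) h x) (≡⇒T Sx)
  hz = ⇒ᵇ-elim (∀ᵇ-sound 4 (λ y → S y ⇒ᵇ (∀ᵇ 4 λ z → S z ⇒ᵇ S ((x ⊕ y) ⊕ z))) hy y) (≡⇒T Sy)

closedᵇ-complete : ∀ S → Closed S → T (closedᵇ S)
closedᵇ-complete S closed =
  ∀ᵇ-complete 4 _ λ x → ⇒ᵇ-intro (S x) λ Sx →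
  ∀ᵇ-complete 4 _ λ y → ⇒ᵇ-intro (S y) λ Sy →
  ∀ᵇ-complete 4 _ λ z → ⇒ᵇ-intro (S z) λ Sz →
  ≡⇒T (closed x y z (T⇒≡ Sx) (T⇒≡ Sy) (T⇒≡ Sz))


Closed-resp : ∀ {S S'} → S ≐ S' → Closed S → Closed S'
Closed-resp S≐S' closed x y z Sx Sy Sz =
  trans (sym (S≐S' _)) (closed x y z (trans (S≐S' x) Sx) (trans (S≐S' y) Sy) (trans (S≐S' z) Sz))

card-resp : ∀ {S S'} → S ≐ S' → card S ≡ card S'
card-resp S≐S' = cong sum (List.map-cong (λ ω → cong (λ b → if b then 1 else 0) (S≐S' ω)) allΩ)

cardOn : List Ω → SubΩ → ℕ
cardOn points S = sum (List.map (λ ω → if S ω then 1 else 0) points)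

cubicFreeᵇ : Vec (List Ω) 5 → SubΩ → Bool
cubicFreeᵇ cubes S = ⌊ highCoefficientsOn cubes S ≟ⱽ replicate 5 false ⌋

subspaceCheckAt : ℕ → Vec (List Ω) 5 → SubΩ → Bool
subspaceCheckAt c cubes S =
  (((c ≡ᵇ 4) ∧ closedᵇ S) ⇒ᵇ cubicFreeᵇ cubes S) ∧
  (((c ≡ᵇ 8) ∧ closedᵇ S) ⇒ᵇ (cubicFreeᵇ cubes S ∧ ⌊ quadPart (anfOf S) ≟ⱽ 0⁶ ⌋))

subspaceCheck : List Ω → Vec (List Ω) 5 → Table 4 → Bool
subspaceCheck points cubes t = subspaceCheckAt (cardOn points (lookupᵀ t)) cubes (lookupᵀ t)

subspaceCheck-passes : ∀ᵀ 4 (subspaceCheck allΩ highCubes) ≡ true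
subspaceCheck-passes = refl

module _ (S : SubΩ) where
  private
    G = tabulated S
    check : T (((card G ≡ᵇ 4) ∧ closedᵇ G) ⇒ᵇ cubicFreeᵇ highCubes G) ×
            T (((card G ≡ᵇ 8) ∧ closedᵇ G) ⇒ᵇ (cubicFreeᵇ highCubes G ∧ ⌊ quadPart (anfOf G) ≟ⱽ 0⁶ ⌋))
    check = Equivalence.to T-∧ (∀ᵀ-sound 4 (subspaceCheck allΩ highCubes) subspaceCheck-passes (tabulateᵀ 4 S))

    premise : ∀ r n → AffineOfCodim r S → 2 ^ (4 ∸ r) ≡ n → T ((card G ≡ᵇ n) ∧ closedᵇ G)
    premise r n ((_ , closed) , cardS) refl = Equivalence.from T-∧
      ( ≡⇒≡ᵇ _ _ (trans (card-resp (tabulated-≐ S)) cardS)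
      , closedᵇ-complete G (Closed-resp (λ ω → sym (tabulated-≐ S ω)) closed))

    cubicFree⇒sound : T (cubicFreeᵇ highCubes G) → S ≐ evalANF (anfOf S)
    cubicFree⇒sound h = anfOf-sound S (trans (sym (highCoefficients-resp (tabulated-≐ S))) (toWitness h))

  codim2⇒Degree≤2 : AffineOfCodim 2 S → Degree≤2 S
  codim2⇒Degree≤2 codim2 =
    anfOf S , cubicFree⇒sound (⇒ᵇ-elim {(card G ≡ᵇ 4) ∧ closedᵇ G} (proj₁ check) (premise 2 4 codim2 refl))

  codim1⇒Degree≤1 : AffineOfCodim 1 S → Degree≤1 S
  codim1⇒Degree≤1 codim1 =
    affinePart (anfOf S) , subst (λ b → S ≐ evalANF (anf (affinePart (anfOf S)) b)) quad≡0 (cubicFree⇒sound cubicFree)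
    where
    conclusion : T (cubicFreeᵇ highCubes G) × T ⌊ quadPart (anfOf G) ≟ⱽ 0⁶ ⌋
    conclusion = Equivalence.to T-∧ (⇒ᵇ-elim {(card G ≡ᵇ 8) ∧ closedᵇ G} (proj₂ check) (premise 1 8 codim1 refl))
    cubicFree = proj₁ conclusion
    quad≡0 : quadPart (anfOf S) ≡ 0⁶
    quad≡0 = trans (cong quadPart (anfOf-resp (λ ω → sym (tabulated-≐ S ω)))) (toWitness (proj₂ conclusion))


Degree≤2-∘⋆ : ∀ {F} → Degree≤2 F → ∀ N → Degree≤2 (λ ω → F (ω ⋆ N))
Degree≤2-∘⋆ {F} (q , F≐q) N = Δ³-vanishing⇒Degree≤2 (λ ω → F (ω ⋆ N)) λ x u v w → begin
  Δ (u ∷ v ∷ w ∷ []) (λ ω → F (ω ⋆ N)) x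
    ≡⟨ Δ-∘⋆ (u ∷ v ∷ w ∷ []) F N x ⟩
  Δ (u ⋆ N ∷ v ⋆ N ∷ w ⋆ N ∷ []) F (x ⋆ N)
    ≡⟨ Δ-∷ (u ⋆ N) (v ⋆ N ∷ w ⋆ N ∷ []) F (x ⋆ N) ⟩
  Δ (v ⋆ N ∷ w ⋆ N ∷ []) F (x ⋆ N) xor Δ (v ⋆ N ∷ w ⋆ N ∷ []) F ((x ⋆ N) ⊕ (u ⋆ N))
    ≡⟨ cong₂ _xor_ (Δ²-polar {q = q} F≐q (x ⋆ N) (v ⋆ N) (w ⋆ N)) (Δ²-polar {q = q} F≐q ((x ⋆ N) ⊕ (u ⋆ N)) (v ⋆ N) (w ⋆ N)) ⟩
  polar (quadPart q) (v ⋆ N) (w ⋆ N) xor polar (quadPart q) (v ⋆ N) (w ⋆ N)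
    ≡⟨ xor-same (polar (quadPart q) (v ⋆ N) (w ⋆ N)) ⟩
  false ∎
  where open ≡-Reasoning

-- Reed–Muller codes are the functions of bounded degree

sumₛ-++ : ∀ L L' ω → sumₛ (L ++ L') ω ≡ sumₛ L ω xor sumₛ L' ω
sumₛ-++ []      L' ω = refl
sumₛ-++ (S ∷ L) L' ω = trans (cong (S ω xor_) (sumₛ-++ L L' ω)) (sym (xor-assoc (S ω) (sumₛ L ω) (sumₛ L' ω)))

RM-resp : ∀ {r A B} → A ≐ B → RM r A → RM r B
RM-resp A≐B (L , affine , A≐L) = L , affine , λ ω → trans (sym (A≐B ω)) (A≐L ω)

RM-∅ : ∀ {r} → RM r ∅ₛ
RM-∅ = [] , [] , λ _ → refl

RM-+ : ∀ {r A B} → RM r A → RM r B → RM r (A +ₛ B)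
RM-+ (L , affine , A≐L) (L' , affine' , B≐L') =
  L ++ L' , ++⁺ affine affine' , λ ω → trans (cong₂ _xor_ (A≐L ω) (B≐L' ω)) (sym (sumₛ-++ L L' ω))

RM2⇒Degree≤2 : ∀ {A} → RM 2 A → Degree≤2 A
RM2⇒Degree≤2 (L , codim2 , A≐L) = Degree≤2-resp (λ ω → sym (A≐L ω)) (sum-Degree≤2 L codim2)
  where
  sum-Degree≤2 : ∀ L → All (AffineOfCodim 2) L → Degree≤2 (sumₛ L)
  sum-Degree≤2 []      []       = anf (replicate 5 false) 0⁶ , λ _ → refl
  sum-Degree≤2 (S ∷ L) (s ∷ ss) = Degree≤2-+ (codim2⇒Degree≤2 S s) (sum-Degree≤2 L ss)

RM1⇒Degree≤1 : ∀ {A} → RM 1 A → Degree≤1 A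
RM1⇒Degree≤1 (L , codim1 , A≐L) = Degree≤1-resp (λ ω → sym (A≐L ω)) (sum-Degree≤1 L codim1)
  where
  sum-Degree≤1 : ∀ L → All (AffineOfCodim 1) L → Degree≤1 (sumₛ L)
  sum-Degree≤1 []      []       = replicate 5 false , λ _ → refl
  sum-Degree≤1 (S ∷ L) (s ∷ ss) = Degree≤1-+ (codim1⇒Degree≤1 S s) (sum-Degree≤1 L ss)

RM-combination : ∀ {r n} (c : Vec Bool n) (ms : Vec SubΩ n) → VecAll.All (RM r) ms →
                 RM r (λ ω → c · values ms ω)
RM-combination {r} []          []       []       = RM-∅ {r}
RM-combination {r} (true ∷ c)  (m ∷ ms) (h ∷ hs) = RM-+ {r} h (RM-combination {r} c ms hs)
RM-combination {r} (false ∷ c) (m ∷ ms) (h ∷ hs) = RM-+ {r} (RM-∅ {r}) (RM-combination {r} c ms hs)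

isAffineOfCodimᵇ : ℕ → SubΩ → Bool
isAffineOfCodimᵇ r S = ⌊ Any.any? (λ ω → S ω ≟ᵇ true) allΩ ⌋ ∧ (closedᵇ S ∧ (card S ≡ᵇ 2 ^ (4 ∸ r)))

isAffineOfCodimᵇ-sound : ∀ r S → T (isAffineOfCodimᵇ r S) → AffineOfCodim r S
isAffineOfCodimᵇ-sound r S h =
  (satisfied (toWitness (∧-fst {nonempty} h)) , closedᵇ-sound S (∧-fst {closedᵇ S} rest)) , ≡ᵇ⇒≡ _ _ (∧-snd {closedᵇ S} rest)
  where
  nonempty = ⌊ Any.any? (λ ω → S ω ≟ᵇ true) allΩ ⌋
  rest = ∧-snd {nonempty} h

spansᵇ : ℕ → List SubΩ → SubΩ → Bool
spansᵇ r L A = all (isAffineOfCodimᵇ r) L ∧ (A =ᶠ sumₛ L)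

spanned : ∀ r L {A} → {T (spansᵇ r L A)} → RM r A
spanned r L {A} {h} =
  L , all-affine L (∧-fst {all (isAffineOfCodimᵇ r) L} h) , =ᶠ-sound A (sumₛ L) (∧-snd {all (isAffineOfCodimᵇ r) L} h)
  where
  all-affine : ∀ L → T (all (isAffineOfCodimᵇ r) L) → All (AffineOfCodim r) L
  all-affine []      _ = []
  all-affine (S ∷ L) h =
    isAffineOfCodimᵇ-sound r S (∧-fst {isAffineOfCodimᵇ r S} h) ∷ all-affine L (∧-snd {isAffineOfCodimᵇ r S} h)

face : Fin 4 → Bool → Fin 4 → Bool → SubΩ
face i a j b ω = ⌊ coord i ω ≟ᵇ a ⌋ ∧ ⌊ coord j ω ≟ᵇ b ⌋

hyperplane : Fin 4 → Bool → SubΩ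
hyperplane i a ω = ⌊ coord i ω ≟ᵇ a ⌋

affineMonomials-RM2 : VecAll.All (RM 2) affineMonomials
affineMonomials-RM2 =
  spanned 2 (face 0F false 1F false ∷ face 0F false 1F true ∷ face 0F true 1F false ∷ face 0F true 1F true ∷ []) ∷
  spanned 2 (face 0F true 1F false ∷ face 0F true 1F true ∷ []) ∷
  spanned 2 (face 1F true 2F false ∷ face 1F true 2F true ∷ []) ∷
  spanned 2 (face 2F true 3F false ∷ face 2F true 3F true ∷ []) ∷
  spanned 2 (face 3F true 0F false ∷ face 3F true 0F true ∷ []) ∷ []

quadMonomials-RM2 : VecAll.All (RM 2) quadMonomials
quadMonomials-RM2 =
  spanned 2 (face 0F true 1F true ∷ []) ∷ spanned 2 (face 0F true 2F true ∷ []) ∷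
  spanned 2 (face 0F true 3F true ∷ []) ∷ spanned 2 (face 1F true 2F true ∷ []) ∷
  spanned 2 (face 1F true 3F true ∷ []) ∷ spanned 2 (face 2F true 3F true ∷ []) ∷ []

affineMonomials-RM1 : VecAll.All (RM 1) affineMonomials
affineMonomials-RM1 =
  spanned 1 (hyperplane 0F false ∷ hyperplane 0F true ∷ []) ∷ spanned 1 (hyperplane 0F true ∷ []) ∷
  spanned 1 (hyperplane 1F true ∷ []) ∷ spanned 1 (hyperplane 2F true ∷ []) ∷ spanned 1 (hyperplane 3F true ∷ []) ∷ []

Degree≤2⇒RM2 : ∀ {A} → Degree≤2 A → RM 2 A
Degree≤2⇒RM2 (anf a b , A≐q) =
  RM-resp {2} (λ ω → sym (A≐q ω))
    (RM-+ {2} (RM-combination {2} a affineMonomials affineMonomials-RM2)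
              (RM-combination {2} b quadMonomials quadMonomials-RM2))

Degree≤1⇒RM1 : ∀ {A} → Degree≤1 A → RM 1 A
Degree≤1⇒RM1 (a , A≐a) =
  RM-resp {1} (λ ω → sym (A≐a ω)) (RM-+ {1} (RM-combination {1} a affineMonomials affineMonomials-RM1) (RM-∅ {1}))

-- Weights of the cosets of RM(1,4) in RM(2,4)

weight : ANF → ℕ
weight q = card (evalANF q)

weights : List ℕ
weights = 0 ∷ 6 ∷ 8 ∷ 10 ∷ 16 ∷ []

-- The Pfaffian: the alternating form with these coefficients is nondegenerate iff pf is true.
pf : Vec Bool 6 → Bool
pf (b₀₁ ∷ b₀₂ ∷ b₀₃ ∷ b₁₂ ∷ b₁₃ ∷ b₂₃ ∷ []) = (b₀₁ ∧ b₂₃) xor ((b₀₂ ∧ b₁₃) xor (b₀₃ ∧ b₁₂))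

Reaches : ℕ → ANF → Set
Reaches n q = Σ (Vec Bool 5) λ a → weight (q ⊞ affine a) ≡ n

reachesᵇ : ℕ → ANF → Bool
reachesᵇ n q = ⌊ Any.any? (λ a → weight (q ⊞ affine a) ℕ.≟ n) (allVec 5) ⌋

reachesᵇ-sound : ∀ n q → T (reachesᵇ n q) → Reaches n q
reachesᵇ-sound n q h = satisfied (toWitness h)

cosetCheck : ANF → Bool
cosetCheck q =
  (⌊ quadPart q ≟ⱽ 0⁶ ⌋ ⇒ᵇ (⌊ weight q ∈? weights ⌋ ∧ (reachesᵇ 0 q ∧ (reachesᵇ 8 q ∧ reachesᵇ 16 q)))) ∧
  (pf (quadPart q) ⇒ᵇ (⌊ weight q ∈? weights ⌋ ∧ (reachesᵇ 6 q ∧ reachesᵇ 10 q)))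

cosetCheck-passes : ∀ᴬ cosetCheck ≡ true
cosetCheck-passes = refl

cosetCheck-sound : ∀ q → T (cosetCheck q)
cosetCheck-sound = ∀ᴬ-sound cosetCheck cosetCheck-passes

affine-coset-weights : ∀ q → quadPart q ≡ 0⁶ → weight q ∈ weights × Reaches 0 q × Reaches 8 q × Reaches 16 q
affine-coset-weights q quad≡0 =
  toWitness (∧-fst {⌊ weight q ∈? weights ⌋} h) ,
  reachesᵇ-sound 0 q (∧-fst {reachesᵇ 0 q} r) ,
  reachesᵇ-sound 8 q (∧-fst {reachesᵇ 8 q} (∧-snd {reachesᵇ 0 q} r)) ,
  reachesᵇ-sound 16 q (∧-snd {reachesᵇ 8 q} (∧-snd {reachesᵇ 0 q} r))
  where
  isAffine = ⌊ quadPart q ≟ⱽ 0⁶ ⌋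
  h : T (⌊ weight q ∈? weights ⌋ ∧ (reachesᵇ 0 q ∧ (reachesᵇ 8 q ∧ reachesᵇ 16 q)))
  h = ⇒ᵇ-elim {isAffine} (∧-fst {isAffine ⇒ᵇ _} (cosetCheck-sound q)) (fromWitness quad≡0)
  r = ∧-snd {⌊ weight q ∈? weights ⌋} h

bent-coset-weights : ∀ q → T (pf (quadPart q)) → weight q ∈ weights × Reaches 6 q × Reaches 10 q
bent-coset-weights q bent =
  toWitness (∧-fst {⌊ weight q ∈? weights ⌋} h) ,
  reachesᵇ-sound 6 q (∧-fst {reachesᵇ 6 q} r) ,
  reachesᵇ-sound 10 q (∧-snd {reachesᵇ 6 q} r)
  where
  isAffine = ⌊ quadPart q ≟ⱽ 0⁶ ⌋
  h : T (⌊ weight q ∈? weights ⌋ ∧ (reachesᵇ 6 q ∧ reachesᵇ 10 q))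
  h = ⇒ᵇ-elim {pf (quadPart q)} (∧-snd {isAffine ⇒ᵇ _} (cosetCheck-sound q)) bent
  r = ∧-snd {⌊ weight q ∈? weights ⌋} h

-- Alternating forms invariant under an element of order five

infix 4 _≟ᴹ_
_≟ᴹ_ : DecidableEquality Mat
_≟ᴹ_ = ≡-dec _≟Ω_

∀ᴹ : (Mat → Bool) → Bool
∀ᴹ p = ∀ᵇ 4 λ r₀ → ∀ᵇ 4 λ r₁ → ∀ᵇ 4 λ r₂ → ∀ᵇ 4 λ r₃ → p (r₀ ∷ r₁ ∷ r₂ ∷ r₃ ∷ [])

∀ᴹ-sound : ∀ p → ∀ᴹ p ≡ true → ∀ N → T (p N)
∀ᴹ-sound p h (r₀ ∷ r₁ ∷ r₂ ∷ r₃ ∷ []) =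
  ∀ᵇ-sound 4 (λ r₃ → p (r₀ ∷ r₁ ∷ r₂ ∷ r₃ ∷ []))
    (∀ᵇ-sound 4 (λ r₂ → ∀ᵇ 4 λ r₃ → p (r₀ ∷ r₁ ∷ r₂ ∷ r₃ ∷ []))
      (∀ᵇ-sound 4 (λ r₁ → ∀ᵇ 4 λ r₂ → ∀ᵇ 4 λ r₃ → p (r₀ ∷ r₁ ∷ r₂ ∷ r₃ ∷ []))
        (∀ᵇ-sound 4 (λ r₀ → ∀ᵇ 4 λ r₁ → ∀ᵇ 4 λ r₂ → ∀ᵇ 4 λ r₃ → p (r₀ ∷ r₁ ∷ r₂ ∷ r₃ ∷ [])) (≡⇒T h) r₀)
      r₁) r₂) r₃

preservesᵇ : Mat → Vec Bool 6 → Bool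
preservesᵇ N b =
  ⌊ VecAll.all? (λ (i , j) → polar b (lookup I₄ i ⋆ N) (lookup I₄ j ⋆ N) ≟ᵇ polar b (lookup I₄ i) (lookup I₄ j)) pairs ⌋

order5Check : Mat → Bool
order5Check N =
  ⌊ N ^ᴹ 5 ≟ᴹ I₄ ⌋ ⇒ᵇ (⌊ ¬? (N ≟ᴹ I₄) ⌋ ⇒ᵇ ∀ᵇ 6 λ b → ⌊ ¬? (b ≟ⱽ 0⁶) ⌋ ⇒ᵇ (preservesᵇ N b ⇒ᵇ pf b))

order5Check-passes : ∀ᴹ order5Check ≡ true
order5Check-passes = refl

order5-invariant-nondegenerate : ∀ N b → N ^ᴹ 5 ≡ I₄ → N ≢ I₄ → b ≢ 0⁶ →
                                 (∀ u v → polar b (u ⋆ N) (v ⋆ N) ≡ polar b u v) → T (pf b)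
order5-invariant-nondegenerate N b order5 nontrivial nonzero invariant =
  ⇒ᵇ-elim {preservesᵇ N b}
    (⇒ᵇ-elim {⌊ ¬? (b ≟ⱽ 0⁶) ⌋} (∀ᵇ-sound 6 invariantForms forms b) (fromWitness nonzero))
    (fromWitness (VecAll.universal (λ (i , j) → invariant (lookup I₄ i) (lookup I₄ j)) pairs))
  where
  invariantForms : Vec Bool 6 → Bool
  invariantForms b = ⌊ ¬? (b ≟ⱽ 0⁶) ⌋ ⇒ᵇ (preservesᵇ N b ⇒ᵇ pf b)
  forms : T (∀ᵇ 6 invariantForms)
  forms = ⇒ᵇ-elim {⌊ ¬? (N ≟ᴹ I₄) ⌋}
            (⇒ᵇ-elim {⌊ N ^ᴹ 5 ≟ᴹ I₄ ⌋} (∀ᴹ-sound order5Check order5Check-passes N) (fromWitness order5))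
            (fromWitness nontrivial)

~-sym : ∀ {S T} → S ~ T → T ~ S
~-sym (inj₁ S≡T)  = inj₁ λ i → sym (S≡T i)
~-sym (inj₂ S≡¬T) = inj₂ λ i → trans (sym (not-involutive _)) (cong not (sym (S≡¬T i)))

~-trans : ∀ {S T U} → S ~ T → T ~ U → S ~ U
~-trans (inj₁ S≡T)  (inj₁ T≡U)  = inj₁ λ i → trans (S≡T i) (T≡U i)
~-trans (inj₁ S≡T)  (inj₂ T≡¬U) = inj₂ λ i → trans (S≡T i) (T≡¬U i)
~-trans (inj₂ S≡¬T) (inj₁ T≡U)  = inj₂ λ i → trans (S≡¬T i) (cong not (T≡U i))
~-trans {U = U} (inj₂ S≡¬T) (inj₂ T≡¬U) = inj₁ λ i → trans (S≡¬T i) (trans (cong not (T≡¬U i)) (not-involutive (U i)))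

◃₈-resp-~ : ∀ {S T} σ → S ~ T → (S ◃₈ σ) ~ (T ◃₈ σ)
◃₈-resp-~ σ (inj₁ S≡T)  = inj₁ λ i → S≡T (invp σ i)
◃₈-resp-~ σ (inj₂ S≡¬T) = inj₂ λ i → S≡¬T (invp σ i)

~⇒+₈~∅ : ∀ {S T} → S ~ T → (S +₈ T) ~ ∅₈
~⇒+₈~∅ {T = T} (inj₁ S≡T)  = inj₁ λ i → trans (cong (_xor T i) (S≡T i)) (xor-same (T i))
~⇒+₈~∅ {T = T} (inj₂ S≡¬T) = inj₂ λ i → trans (cong (_xor T i) (S≡¬T i)) (xor-inverseˡ (T i))

pair1-zero : pair1 0F ~ ∅₈
pair1-zero = inj₁ λ i → xor-same ⌊ i ≟ 0F ⌋

pair1-~∅ : ∀ j → pair1 j ~ ∅₈ → j ≡ 0F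
pair1-~∅ = from-yes (all? λ j → ((all? λ i → pair1 j i ≟ᵇ false) ⊎-dec
                                 (all? λ i → pair1 j i ≟ᵇ true)) →-dec (j ≟ 0F))

fold-cong : ∀ {f g : Fin 8 → Fin 8} → (∀ k → f k ≡ g k) → ∀ i n → fold i f n ≡ fold i g n
fold-cong f≡g i zero    = refl
fold-cong {f} {g} f≡g i (suc n) = trans (f≡g (fold i f n)) (cong g (fold-cong f≡g i n))

invp-cong : ∀ σ τ → (∀ i → fun σ i ≡ fun τ i) → ∀ i → invp σ i ≡ invp τ i
invp-cong σ τ σ≡τ i = begin
  invp σ i                    ≡⟨ cong (invp σ) (fun∘invp τ i) ⟨
  invp σ (fun τ (invp τ i))   ≡⟨ cong (invp σ) (σ≡τ (invp τ i)) ⟨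
  invp σ (fun σ (invp τ i))   ≡⟨ invp∘fun σ (invp τ i) ⟩
  invp τ i                    ∎
  where open ≡-Reasoning

cycle : List (Fin 8) → Fin 8 → Fin 8
cycle []       i = i
cycle (c ∷ cs) i = go (c ∷ cs)
  where
  go : List (Fin 8) → Fin 8
  go []           = i
  go (a ∷ [])     = if ⌊ i ≟ a ⌋ then c else i
  go (a ∷ b ∷ as) = if ⌊ i ≟ a ⌋ then b else go (b ∷ as)

fiveCycle : Fin 8 → List (Fin 8)
fiveCycle j = List.take 5 (List.filter (λ i → ¬? (i ≟ 0F) ×-dec ¬? (i ≟ j)) (List.allFin 8))

stabiliser : Fin 8 → Perm8
stabiliser j = record
  { fun = cycle (fiveCycle j) ; invp = cycle (List.reverse (fiveCycle j))
  ; invp∘fun = from-yes (all? λ j → all? λ i → cycle (List.reverse (fiveCycle j)) (cycle (fiveCycle j) i) ≟ i) j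
  ; fun∘invp = from-yes (all? λ j → all? λ i → cycle (fiveCycle j) (cycle (List.reverse (fiveCycle j)) i) ≟ i) j }

stabiliser-even : ∀ j → IsEven (stabiliser j)
stabiliser-even = from-yes (all? λ j → inversions (stabiliser j) % 2 ℕ.≟ 0)

stabiliser-fixes-pair1 : ∀ j → (pair1 j ◃₈ stabiliser j) ~ pair1 j
stabiliser-fixes-pair1 j = inj₁ (from-yes (all? λ j → all? λ i → (pair1 j ◃₈ stabiliser j) i ≟ᵇ pair1 j i) j)

stabiliser-order5 : ∀ j i → fold i (fun (stabiliser j)) 5 ≡ i
stabiliser-order5 = from-yes (all? λ j → all? λ i → fold i (fun (stabiliser j)) 5 ≟ i)

stabiliser-nontrivial : ∀ j → ∃ λ i → fun (stabiliser j) i ≢ i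
stabiliser-nontrivial = from-yes (all? λ j → any? λ i → ¬? (fun (stabiliser j) i ≟ i))

threeCycle : Perm8
threeCycle = record
  { fun = cycle (0F ∷ 1F ∷ 2F ∷ []) ; invp = cycle (2F ∷ 1F ∷ 0F ∷ [])
  ; invp∘fun = from-yes (all? λ i → cycle (2F ∷ 1F ∷ 0F ∷ []) (cycle (0F ∷ 1F ∷ 2F ∷ []) i) ≟ i)
  ; fun∘invp = from-yes (all? λ i → cycle (0F ∷ 1F ∷ 2F ∷ []) (cycle (2F ∷ 1F ∷ 0F ∷ []) i) ≟ i) }

threeCycle-even : IsEven threeCycle
threeCycle-even = refl

module Classification (S : Setup) where
  open Setup S

  φ-identity : ∀ i → fun (φ 1ᴳ) i ≡ i
  φ-identity i = begin
    fun (φ 1ᴳ) i                            ≡⟨ invp∘fun (φ 1ᴳ) (fun (φ 1ᴳ) i) ⟨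
    invp (φ 1ᴳ) (fun (φ 1ᴳ) (fun (φ 1ᴳ) i)) ≡⟨ cong (invp (φ 1ᴳ)) (φ-hom 1ᴳ 1ᴳ 1ᴳ refl i) ⟨
    invp (φ 1ᴳ) (fun (φ 1ᴳ) i)              ≡⟨ invp∘fun (φ 1ᴳ) i ⟩
    i                                       ∎
    where open ≡-Reasoning

  φ-trivial : ∀ g → mat g ≡ I₄ → ∀ i → fun (φ g) i ≡ i
  φ-trivial g g≡I i = trans (φ-hom 1ᴳ 1ᴳ g g≡I i) (trans (φ-identity _) (φ-identity i))

  φ-power : ∀ g n i → fun (φ (g ^ᴳ n)) i ≡ fold i (fun (φ g)) n
  φ-power g zero    i = φ-identity i
  φ-power g (suc n) i = trans (φ-hom (g ^ᴳ n) g (g ^ᴳ suc n) refl i) (cong (fun (φ g)) (φ-power g n i))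

  φ-order5 : ∀ g → (∀ i → fold i (fun (φ g)) 5 ≡ i) → mat g ^ᴹ 5 ≡ I₄
  φ-order5 g order5 =
    trans (sym (mat-^ᴳ g 5)) (φ-inj (g ^ᴳ 5) 1ᴳ λ i → trans (φ-power g 5 i) (trans (order5 i) (sym (φ-identity i))))

  -- If φ g fixes the class of f̄(x), then f(x)·g and f(x) differ by an element of RM(1,4), so g
  -- preserves the polar form of f(x).
  polar-invariant : ∀ x q g → f x ≐ evalANF q → (ψ (f x) ◃₈ φ g) ~ ψ (f x) →
                    ∀ u v → polar (quadPart q) (u ⋆ inv g) (v ⋆ inv g) ≡ polar (quadPart q) u v
  polar-invariant x q g fx≐q fixes u v = begin
    polar (quadPart q) (u ⋆ inv g) (v ⋆ inv g) ≡⟨ Δ²-polar {q = q} fx≐q (0Ω ⋆ inv g) (u ⋆ inv g) (v ⋆ inv g) ⟨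
    Δ (u ⋆ inv g ∷ v ⋆ inv g ∷ []) (f x) (0Ω ⋆ inv g) ≡⟨ Δ-∘⋆ (u ∷ v ∷ []) (f x) (inv g) 0Ω ⟨
    Δ (u ∷ v ∷ []) (f x ◃ g) 0Ω ≡⟨ xor≡false⇒≡ _ _ Δ²-difference ⟩
    Δ (u ∷ v ∷ []) (f x) 0Ω ≡⟨ Δ²-polar {q = q} fx≐q 0Ω u v ⟩
    polar (quadPart q) u v ∎
    where
    open ≡-Reasoning
    translate-RM2 : RM 2 (f x ◃ g)
    translate-RM2 = Degree≤2⇒RM2 (Degree≤2-∘⋆ (q , fx≐q) (inv g))
    difference : RM 1 ((f x ◃ g) +ₛ f x)
    difference = proj₁ (ψ-ker _ (RM-+ {2} translate-RM2 (f-D x)))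
      (~-trans (ψ-add _ _ translate-RM2 (f-D x)) (~⇒+₈~∅ (~-trans (ψ-equiv (f x) g (f-D x)) fixes)))
    Δ²-difference : Δ (u ∷ v ∷ []) (f x ◃ g) 0Ω xor Δ (u ∷ v ∷ []) (f x) 0Ω ≡ false
    Δ²-difference = trans (sym (Δ-+ (u ∷ v ∷ []) (f x ◃ g) (f x) 0Ω)) (Degree≤1-Δ² (RM1⇒Degree≤1 difference) 0Ω u v)

  affine-if-fixed : ∀ x q → f x ≐ evalANF q → fun (φ (lin x)) 0F ≡ 0F → quadPart q ≡ 0⁶
  affine-if-fixed x q fx≐q fixed =
    cong quadPart (evalANF-injective {q} {affine (proj₁ affine-fx)} λ ω → trans (sym (fx≐q ω)) (proj₂ affine-fx ω))
    where
    class : ψ (f x) ~ ∅₈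
    class = ~-trans (subst (λ j → ψ (f x) ~ pair1 j) fixed (f-bar x)) pair1-zero
    affine-fx : Degree≤1 (f x)
    affine-fx = RM1⇒Degree≤1 (proj₁ (ψ-ker (f x) (f-D x)) class)

  bent-if-moved : ∀ x q → f x ≐ evalANF q → fun (φ (lin x)) 0F ≢ 0F → T (pf (quadPart q))
  bent-if-moved x q fx≐q moved = order5-invariant-nondegenerate (mat g) (quadPart q) order5 nontrivial nonzero invariant
    where
    j = fun (φ (lin x)) 0F
    class = f-bar x
    g = proj₁ (φ-surj (stabiliser j) (stabiliser-even j))
    φg≡σ = proj₂ (φ-surj (stabiliser j) (stabiliser-even j))
    order5 : mat g ^ᴹ 5 ≡ I₄
    order5 = φ-order5 g λ i → trans (fold-cong φg≡σ i 5) (stabiliser-order5 j i)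
    nontrivial : mat g ≢ I₄
    nontrivial g≡I = proj₂ (stabiliser-nontrivial j) (trans (sym (φg≡σ _)) (φ-trivial g g≡I _))
    nonzero : quadPart q ≢ 0⁶
    nonzero b≡0 = moved (pair1-~∅ j (~-trans (~-sym class) (proj₂ (ψ-ker (f x) (f-D x)) (Degree≤1⇒RM1 affine-fx))))
      where
      affine-fx : Degree≤1 (f x)
      affine-fx = affinePart q , subst (λ b → f x ≐ evalANF (anf (affinePart q) b)) b≡0 fx≐q
    fixes : (ψ (f x) ◃₈ φ g) ~ ψ (f x)
    fixes = ~-trans (◃₈-resp-~ (φ g) class)
            (~-trans (inj₁ λ i → cong (pair1 j) (invp-cong (φ g) (stabiliser j) φg≡σ i))
            (~-trans (stabiliser-fixes-pair1 j) (~-sym class)))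
    invariant : ∀ u v → polar (quadPart q) (u ⋆ mat g) (v ⋆ mat g) ≡ polar (quadPart q) u v
    invariant u v = trans (sym (polar-invariant x q g fx≐q fixes (u ⋆ mat g) (v ⋆ mat g)))
                          (cong₂ (polar (quadPart q)) (⋆-cancel g u) (⋆-cancel g v))

  quadPart-dichotomy : ∀ x q → f x ≐ evalANF q → quadPart q ≡ 0⁶ ⊎ T (pf (quadPart q))
  quadPart-dichotomy x q fx≐q with fun (φ (lin x)) 0F ≟ 0F
  ... | yes fixed = inj₁ (affine-if-fixed x q fx≐q fixed)
  ... | no  moved = inj₂ (bent-if-moved x q fx≐q moved)

  Attained : ℕ → Set
  Attained n = ∃ λ A → card A ≡ n × ∃ λ x → ∃ λ d → RM 1 d × A ≐ (f x +ₛ d)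

  attained : ∀ x q n → f x ≐ evalANF q → Reaches n q → Attained n
  attained x q n fx≐q (a , weight≡n) =
    f x +ₛ evalANF (affine a) ,
    trans (card-resp λ ω → trans (cong (_xor evalANF (affine a) ω) (fx≐q ω)) (sym (evalANF-⊞ q (affine a) ω))) weight≡n ,
    x , evalANF (affine a) , Degree≤1⇒RM1 (a , λ _ → refl) , λ _ → refl

  coset-weight : ∀ x d → RM 1 d → card (f x +ₛ d) ∈ weights
  coset-weight x d d∈RM1 = subst (_∈ weights) (sym (card-resp fx+d≐r)) ([ affineCase , bentCase ]′ (quadPart-dichotomy x q fx≐q))
    where
    q = proj₁ (RM2⇒Degree≤2 (f-D x))
    fx≐q = proj₂ (RM2⇒Degree≤2 (f-D x))
    a = proj₁ (RM1⇒Degree≤1 d∈RM1)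
    r = q ⊞ affine a
    fx+d≐r : (f x +ₛ d) ≐ evalANF r
    fx+d≐r ω = trans (cong₂ _xor_ (fx≐q ω) (proj₂ (RM1⇒Degree≤1 d∈RM1) ω)) (sym (evalANF-⊞ q (affine a) ω))
    quadPart-r : quadPart r ≡ quadPart q
    quadPart-r = zipWith-identityʳ xor-identityʳ (quadPart q)
    affineCase = λ q-affine → proj₁ (affine-coset-weights r (trans quadPart-r q-affine))
    bentCase = λ q-bent → proj₁ (bent-coset-weights r (subst (T ∘ pf) (sym quadPart-r) q-bent))

  private
    fixing moving : AGL4
    fixing = record { lin = 1ᴳ ; tr = 0Ω }
    moving = record { lin = proj₁ (φ-surj threeCycle threeCycle-even) ; tr = 0Ω }

    q₀ = proj₁ (RM2⇒Degree≤2 (f-D fixing))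
    fx₀≐q₀ = proj₂ (RM2⇒Degree≤2 (f-D fixing))
    q₁ = proj₁ (RM2⇒Degree≤2 (f-D moving))
    fx₁≐q₁ = proj₂ (RM2⇒Degree≤2 (f-D moving))

    affine₀ = affine-coset-weights q₀ (affine-if-fixed fixing q₀ fx₀≐q₀ (φ-identity 0F))
    bent₁ = bent-coset-weights q₁ (bent-if-moved moving q₁ fx₁≐q₁ λ moved →
              contradiction (trans (sym (proj₂ (φ-surj threeCycle threeCycle-even) 0F)) moved) λ ())

  weights-attained : ∀ {n} → n ∈ weights → Attained n
  weights-attained (here refl)                                 = attained fixing q₀ 0 fx₀≐q₀ (proj₁ (proj₂ affine₀))
  weights-attained (there (here refl))                         = attained moving q₁ 6 fx₁≐q₁ (proj₁ (proj₂ bent₁))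
  weights-attained (there (there (here refl)))                 = attained fixing q₀ 8 fx₀≐q₀ (proj₁ (proj₂ (proj₂ affine₀)))
  weights-attained (there (there (there (here refl))))         = attained moving q₁ 10 fx₁≐q₁ (proj₂ (proj₂ bent₁))
  weights-attained (there (there (there (there (here refl))))) = attained fixing q₀ 16 fx₀≐q₀ (proj₂ (proj₂ (proj₂ affine₀)))

corollary6p4 : (S : Setup) → (n : ℕ) →
    (n ∈ (0 ∷ 6 ∷ 8 ∷ 10 ∷ 16 ∷ [])) ⇔
    (∃ λ A → card A ≡ n × ∃ λ x → ∃ λ d → RM 1 d × A ≐ (Setup.f S x +ₛ d))
corollary6p4 S n = mk⇔ weights-attained λ (A , card≡n , x , d , d∈RM1 , A≐fx+d) →
  subst (_∈ weights) (trans (sym (card-resp A≐fx+d)) card≡n) (coset-weight x d d∈RM1)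
  where open Classification S
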